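{- Let $B_1,B_2$ be fuzzy topological spaces, $\mathcal{R}\subseteq B_1\times B_2$ a relation equipped with the fuzzy subspace topology, and $\pi_1:\mathcal{R}\to B_1$, $\pi_2:\mathcal{R}\to B_2$ the projections. A pair of fuzzy open sets $(\mu,\eta)\in\mathcal{Q}(B_1)\times\mathcal{Q}(B_2)$ is $\mathcal{R}$-coherent if and only if $\mu\circ\pi_1=\eta\circ\pi_2$.
   Context: $\mathcal{Q}(B)$ is the set of fuzzy open sets (maps $B\to[0,1]$ in the fuzzy topology) of $B$. For a fuzzy set $\mu$ on $B_1$, $\mathcal{R}[\mu]$ is the fuzzy set on $B_2$ with $\mathcal{R}[\mu](d')=\sup\{\mu(d):d\mathcal{R}d'\}$ (sup of the empty set is $0$); for a fuzzy set $\eta$ on $B_2$, $\mathcal{R}^{ -1}[\eta](d)=\sup\{\eta(d'):d\mathcal{R}d'\}$. A pair $(\mu,\eta)$ of fuzzy sets on $B_1,B_2$ is $\mathcal{R}$-coherent if $\mathcal{R}[\mu]\le\eta$ and $\mathcal{R}^{ -1}[\eta]\le\mu$ pointwise. -}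

module Defs where

open import Level using (0ℓ)
open import Data.Product using (Σ; _×_; _,_; proj₁; proj₂)
open import Data.Sum using (_⊎_)
open import Relation.Binary.Bundles using (Poset)

-- Agda's stdlib has no real numbers,
-- so [0,1] is abstracted as a complete totally ordered lattice with
-- bottom 0 and top 1 (the properties of [0,1] that the fuzzy notions use).
record UnitInterval : Set₁ where
  field
    poset : Poset 0ℓ 0ℓ 0ℓ
  open Poset poset public renaming (Carrier to I)
  field
    total : ∀ x y → x ≤ y ⊎ y ≤ x
    𝟘 𝟙   : I
    𝟘-min : ∀ x → 𝟘 ≤ x
    𝟙-max : ∀ x → x ≤ 𝟙
    _⊓_    : I → I → I
    ⊓-lb₁  : ∀ x y → (x ⊓ y) ≤ x
    ⊓-lb₂  : ∀ x y → (x ⊓ y) ≤ y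
    ⊓-glb  : ∀ x y z → z ≤ x → z ≤ y → z ≤ (x ⊓ y)
    ⋁      : (J : Set) → (J → I) → I
    ⋁-ub   : ∀ J (f : J → I) (j : J) → f j ≤ ⋁ J f
    ⋁-lub  : ∀ J (f : J → I) (z : I) → (∀ j → f j ≤ z) → ⋁ J f ≤ z

module _ (L : UnitInterval) where
  open UnitInterval L

  FuzzySet : Set → Set
  FuzzySet X = X → I

  _≤F_ : {X : Set} → FuzzySet X → FuzzySet X → Set
  μ ≤F ν = ∀ x → μ x ≤ ν x

  -- Chang fuzzy topology: the open fuzzy sets 𝒬(X)
  record FuzzyTopology (X : Set) : Set₁ where
    field
      Open      : FuzzySet X → Set
      open-𝟘    : Open (λ _ → 𝟘)
      open-𝟙    : Open (λ _ → 𝟙)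
      open-⊓    : ∀ μ ν → Open μ → Open ν → Open (λ x → μ x ⊓ ν x)
      open-⋁    : ∀ (J : Set) (μ : J → FuzzySet X) → (∀ j → Open (μ j))
                  → Open (λ x → ⋁ J (λ j → μ j x))

  image : {B₁ B₂ : Set} → (B₁ → B₂ → Set) → FuzzySet B₁ → FuzzySet B₂
  image {B₁} R μ d' = ⋁ (Σ B₁ (λ d → R d d')) (λ p → μ (proj₁ p))

  preimage : {B₁ B₂ : Set} → (B₁ → B₂ → Set) → FuzzySet B₂ → FuzzySet B₁
  preimage {B₁} {B₂} R η d = ⋁ (Σ B₂ (λ d' → R d d')) (λ p → η (proj₁ p))

  Coherent : {B₁ B₂ : Set} → (B₁ → B₂ → Set) → FuzzySet B₁ → FuzzySet B₂ → Set
  Coherent R μ η = (image R μ ≤F η) × (preimage R η ≤F μ)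

  Rel↑ : {B₁ B₂ : Set} → (B₁ → B₂ → Set) → Set
  Rel↑ {B₁} {B₂} R = Σ (B₁ × B₂) (λ p → R (proj₁ p) (proj₂ p))

  π₁ : {B₁ B₂ : Set} {R : B₁ → B₂ → Set} → Rel↑ R → B₁
  π₁ ((d , _) , _) = d

  π₂ : {B₁ B₂ : Set} {R : B₁ → B₂ → Set} → Rel↑ R → B₂
  π₂ ((_ , d') , _) = d'

{-# OPTIONS --safe #-}
module Submission where

open import Defs
open import Function using (_∘_; _⇔_)
open import Function.Bundles using (mk⇔; module Equivalence)
open import Data.Product using (_,_; proj₁)

-- Both halves of coherence are suprema over the points of R, so each is
-- equivalent to a pointwise inequality between μ ∘ π₁ and η ∘ π₂ on R;
-- the two inequalities together are the equality.

module _ (L : UnitInterval) {B₁ B₂ : Set} (R : B₁ → B₂ → Set)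
         (μ : FuzzySet L B₁) (η : FuzzySet L B₂) where
  open UnitInterval L

  image≤⇔π₁≤π₂ : _≤F_ L (image L R μ) η ⇔ (∀ (r : Rel↑ L R) → μ (π₁ L r) ≤ η (π₂ L r))
  image≤⇔π₁≤π₂ = mk⇔ to from
    where
    to : _≤F_ L (image L R μ) η → ∀ r → μ (π₁ L r) ≤ η (π₂ L r)
    to μR≤η ((d , d') , dRd') = trans (⋁-ub _ (μ ∘ proj₁) (d , dRd')) (μR≤η d')

    from : (∀ r → μ (π₁ L r) ≤ η (π₂ L r)) → _≤F_ L (image L R μ) η
    from π₁≤π₂ d' = ⋁-lub _ _ _ λ { (d , dRd') → π₁≤π₂ ((d , d') , dRd') }

  preimage≤⇔π₂≤π₁ : _≤F_ L (preimage L R η) μ ⇔ (∀ (r : Rel↑ L R) → η (π₂ L r) ≤ μ (π₁ L r))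
  preimage≤⇔π₂≤π₁ = mk⇔ to from
    where
    to : _≤F_ L (preimage L R η) μ → ∀ r → η (π₂ L r) ≤ μ (π₁ L r)
    to ηR≤μ ((d , d') , dRd') = trans (⋁-ub _ (η ∘ proj₁) (d' , dRd')) (ηR≤μ d)

    from : (∀ r → η (π₂ L r) ≤ μ (π₁ L r)) → _≤F_ L (preimage L R η) μ
    from π₂≤π₁ d = ⋁-lub _ _ _ λ { (d' , dRd') → π₂≤π₁ ((d , d') , dRd') }

  coherent⇔π₁≈π₂ : Coherent L R μ η ⇔ (∀ (r : Rel↑ L R) → (μ ∘ π₁ L) r ≈ (η ∘ π₂ L) r)
  coherent⇔π₁≈π₂ = mk⇔ to from
    where
    to : Coherent L R μ η → ∀ r → μ (π₁ L r) ≈ η (π₂ L r)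
    to (μR≤η , ηR≤μ) r =
      antisym (Equivalence.to image≤⇔π₁≤π₂ μR≤η r) (Equivalence.to preimage≤⇔π₂≤π₁ ηR≤μ r)

    from : (∀ r → μ (π₁ L r) ≈ η (π₂ L r)) → Coherent L R μ η
    from π₁≈π₂ = Equivalence.from image≤⇔π₁≤π₂ (λ r → reflexive (π₁≈π₂ r))
               , Equivalence.from preimage≤⇔π₂≤π₁ (λ r → reflexive (Eq.sym (π₁≈π₂ r)))

lemma5p5 : (L : UnitInterval) → let open UnitInterval L in
    {B₁ B₂ : Set} (τ₁ : FuzzyTopology L B₁) (τ₂ : FuzzyTopology L B₂)
    (R : B₁ → B₂ → Set) (μ : FuzzySet L B₁) (η : FuzzySet L B₂) →
    FuzzyTopology.Open τ₁ μ → FuzzyTopology.Open τ₂ η →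
    Coherent L R μ η ⇔ (∀ (r : Rel↑ L R) → (μ ∘ π₁ L) r ≈ (η ∘ π₂ L) r)
lemma5p5 L τ₁ τ₂ R μ η _ _ = coherent⇔π₁≈π₂ L R μ η
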